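{- For every $n\in\mathbb{Z}^+\setminus\{1,3\}$ there exists a graph $G_n$ such that $\gamma_{\rm gr}^t(G_n)=n$.
   Context: All graphs are finite and simple. For a vertex $v$, $N(v)$ is its open neighborhood. A sequence $(v_1,\ldots,v_k)$ of distinct vertices is legal if for every $i\in\{1,\ldots,k\}$, $N(v_i)\setminus\bigcup_{j=1}^{i-1}N(v_j)\neq\emptyset$; it is a total dominating sequence if in addition every vertex has a neighbor among $v_1,\ldots,v_k$. $\gamma_{\rm gr}^t(G)$ is the maximum length of a legal sequence (for graphs with no isolated vertices, the maximum length of a total dominating sequence). -}

module Defs where

open import Data.Nat using (ℕ; _≤_)
open import Data.Fin using (Fin)
open import Data.Bool using (Bool; true; false)
open import Data.List using (List; []; _∷_; length)
open import Data.List.Membership.Propositional using (_∈_)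
open import Data.List.Relation.Unary.Unique.Propositional using (Unique)
open import Data.Product using (Σ; ∃; _×_)
open import Relation.Binary.PropositionalEquality using (_≡_)

record Graph : Set where
  field
    m     : ℕ
    adj   : Fin m → Fin m → Bool
    sym   : ∀ u v → adj u v ≡ adj v u
    irref : ∀ v → adj v v ≡ false

module _ (G : Graph) where
  open Graph G

  _∈N_ : Fin m → Fin m → Set
  w ∈N v = adj v w ≡ true

  -- LegalFrom prev vs : every vertex of vs (taken in order) has a neighbour
  -- not in the neighbourhood of any previously chosen vertex
  -- (prev = the vertices chosen so far).
  data LegalFrom : List (Fin m) → List (Fin m) → Set where
    []  : ∀ {prev} → LegalFrom prev []
    _∷_ : ∀ {prev v vs} →
          (∃ λ w → w ∈N v × (∀ u → u ∈ prev → adj u w ≡ false)) →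
          LegalFrom (v ∷ prev) vs →
          LegalFrom prev (v ∷ vs)

  Legal : List (Fin m) → Set
  Legal vs = Unique vs × LegalFrom [] vs

  GrundyTotalDom≡ : ℕ → Set
  GrundyTotalDom≡ n =
    (∃ λ vs → Legal vs × length vs ≡ n) ×
    (∀ vs → Legal vs → length vs ≤ n)

module Submission where

--  * n = 2k: the perfect matching k·K₂ on 2k vertices.  Listing the pairs
--    one after the other is legal (each vertex uses its partner as the new
--    neighbour), and no legal sequence is longer than the number of
--    vertices, since its vertices are distinct.
--  * n = 2J + 5: the graph on 6 + 2J vertices made of a triangle 1 2 3, a
--    hub 0 adjacent to 1 and to every vertex ≥ 4, and a perfect matching
--    on {4, …, 5 + 2J}.  The sequence 2 3 1 4, then the pairs from 6 on,
--    then 0 is legal.  Every vertex has two distinct neighbours, and the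
--    new neighbours chosen by a legal sequence are distinct and (after the
--    first step) avoid both neighbours of the first vertex, so a legal
--    sequence is at most one shorter than the number of vertices.

open import Defs
open import Data.Nat using (ℕ; zero; suc; pred; _+_; _≤_; _<_; _<?_; z≤n; s≤s)
open import Data.Nat.Properties
  using (≤-refl; ≤-trans; +-monoʳ-≤; <-trans; m≤m+n; m<n⇒m<1+n; +-suc; +-identityʳ; +-comm; pred-mono-≤)
open import Data.Fin using (Fin; toℕ; fromℕ<) renaming (zero to fzero; suc to fsuc)
open import Data.Fin.Properties using (toℕ<n; toℕ-fromℕ<; fromℕ<-injective; injective⇒≤)
open import Data.Bool using (Bool; true; false; _∨_)
open import Data.Bool.Properties using (∨-comm)
open import Data.List using (List; []; _∷_; _++_; length; map; lookup)
open import Data.List.Properties using (length-map)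
open import Data.List.Membership.Propositional using (_∈_; _∉_)
open import Data.List.Membership.Propositional.Properties using (∈-map⁺; ∈-lookup)
open import Data.List.Relation.Unary.Any using (here; there)
open import Data.List.Relation.Unary.All as All using (All; []; _∷_)
open import Data.List.Relation.Unary.AllPairs using ([]; _∷_)
open import Data.List.Relation.Unary.Unique.Propositional using (Unique)
open import Data.Product using (∃; ∃₂; _×_; _,_; proj₁; proj₂)
open import Data.Sum using (_⊎_; inj₁; inj₂)
open import Relation.Nullary using (contradiction)
open import Function using (_∘_)
open import Relation.Nullary.Decidable using (True; toWitness)
open import Relation.Binary.PropositionalEquality
  using (_≡_; _≢_; refl; sym; trans; cong; cong₂; subst)

lookup-injective : ∀ {A : Set} {xs : List A} → Unique xs →
                   ∀ i j → lookup xs i ≡ lookup xs j → i ≡ j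
lookup-injective (_ ∷ _)   fzero    fzero    _ = refl
lookup-injective (x∉ ∷ _)   fzero    (fsuc j) e = contradiction e (All.lookup x∉ (∈-lookup j))
lookup-injective (x∉ ∷ _)   (fsuc i) fzero    e = contradiction (sym e) (All.lookup x∉ (∈-lookup i))
lookup-injective (_ ∷ uxs)  (fsuc i) (fsuc j) e = cong fsuc (lookup-injective uxs i j e)

unique-length≤ : ∀ {m} (xs : List (Fin m)) → Unique xs → length xs ≤ m
unique-length≤ xs uxs = injective⇒≤ (λ {i} {j} → lookup-injective uxs i j)

module _ (G : Graph) where
  open Graph G using (m; adj)

  Avoids : List (Fin m) → Fin m → Set
  Avoids prev w = ∀ u → u ∈ prev → adj u w ≡ false

  adjacent≢nonadjacent : ∀ {v w w′} → adj v w ≡ true → adj v w′ ≡ false → w ≢ w′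
  adjacent≢nonadjacent vw vw′ refl = contradiction (trans (sym vw) vw′) λ ()

  -- A chosen vertex never reappears later: its new neighbour would have to
  -- avoid its own neighbourhood.
  chosen∉later : ∀ {prev vs x} → LegalFrom G prev vs → x ∈ prev → x ∉ vs
  chosen∉later ((w , vw , avoid) ∷ _) x∈ (here refl) =
    adjacent≢nonadjacent vw (avoid _ x∈) refl
  chosen∉later (_ ∷ l) x∈ (there x∈vs) = chosen∉later l (there x∈) x∈vs

  legalFrom⇒unique : ∀ {prev vs} → LegalFrom G prev vs → Unique vs
  legalFrom⇒unique [] = []
  legalFrom⇒unique (_ ∷ l) =
    All.tabulate (λ { x∈ refl → chosen∉later l (here refl) x∈ }) ∷ legalFrom⇒unique l

  witnesses : ∀ {prev vs} → LegalFrom G prev vs → List (Fin m)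
  witnesses [] = []
  witnesses ((w , _) ∷ l) = w ∷ witnesses l

  witnesses-length : ∀ {prev vs} (l : LegalFrom G prev vs) → length (witnesses l) ≡ length vs
  witnesses-length [] = refl
  witnesses-length (_ ∷ l) = cong suc (witnesses-length l)

  witnesses-avoid : ∀ {prev vs} (l : LegalFrom G prev vs) → All (Avoids prev) (witnesses l)
  witnesses-avoid [] = []
  witnesses-avoid ((_ , _ , avoid) ∷ l) =
    avoid ∷ All.map (λ avoid′ u u∈ → avoid′ u (there u∈)) (witnesses-avoid l)

  -- Each new neighbour lies in N(v) for its vertex v, while all later ones
  -- avoid N(v); hence the new neighbours are distinct.
  witnesses-unique : ∀ {prev vs} (l : LegalFrom G prev vs) → Unique (witnesses l)
  witnesses-unique [] = []
  witnesses-unique ((_ , vw , _) ∷ l) =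
    All.map (λ avoid → adjacent≢nonadjacent vw (avoid _ (here refl))) (witnesses-avoid l)
    ∷ witnesses-unique l

  legal-length≤ : ∀ vs → Legal G vs → length vs ≤ m
  legal-length≤ vs (uvs , _) = unique-length≤ vs uvs

  TwoNeighbours : Fin m → Set
  TwoNeighbours v = ∃₂ λ a b → a ≢ b × adj v a ≡ true × adj v b ≡ true

  -- After the first vertex v, the new
  -- neighbours avoid N(v), so together with two neighbours of v they form
  -- 1 + length vs distinct vertices.
  legal-length≤pred : (∀ v → TwoNeighbours v) → ∀ vs → Legal G vs → length vs ≤ pred m
  legal-length≤pred two [] _ = z≤n
  legal-length≤pred two (v ∷ vs) (_ , (_ ∷ l)) with two v
  ... | a , b , a≢b , va , vb =
    subst (λ k → suc k ≤ pred m) (witnesses-length l)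
          (pred-mono-≤ (unique-length≤ (a ∷ b ∷ ws) distinct))
    where
    ws : List (Fin m)
    ws = witnesses l
    outside : ∀ {x} → adj v x ≡ true → All (x ≢_) ws
    outside vx = All.map (λ avoid → adjacent≢nonadjacent vx (avoid v (here refl)))
                         (witnesses-avoid l)
    distinct : Unique (a ∷ b ∷ ws)
    distinct = (a≢b ∷ outside va) ∷ outside vb ∷ witnesses-unique l

Sym : (ℕ → ℕ → Bool) → ℕ → ℕ → Bool
Sym R u v = R u v ∨ R v u

Sym-irrefl : ∀ {R} → (∀ a → R a a ≡ false) → ∀ a → Sym R a a ≡ false
Sym-irrefl irr a = cong (λ b → b ∨ b) (irr a)

-- The graph on {0, …, m−1} in which u ~ v iff R u v or R v u; legal
-- sequences can then be written and checked as lists of numbers.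
graphOf : (R : ℕ → ℕ → Bool) → (∀ a → R a a ≡ false) → ℕ → Graph
graphOf R irr m = record
  { m = m
  ; adj = λ u v → Sym R (toℕ u) (toℕ v)
  ; sym = λ u v → ∨-comm (R (toℕ u) (toℕ v)) (R (toℕ v) (toℕ u))
  ; irref = λ v → Sym-irrefl {R} irr (toℕ v)
  }

data LegalℕFrom (A : ℕ → ℕ → Bool) (m : ℕ) : List ℕ → List ℕ → Set where
  []   : ∀ {prev} → LegalℕFrom A m prev []
  step : ∀ {prev v vs} w → v < m → w < m → A v w ≡ true →
         All (λ u → A u w ≡ false) prev →
         LegalℕFrom A m (v ∷ prev) vs → LegalℕFrom A m prev (v ∷ vs)

module _ (R : ℕ → ℕ → Bool) (irr : ∀ a → R a a ≡ false) (m : ℕ) where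
  open Graph (graphOf R irr m) using (adj)

  adj-fromℕ< : ∀ {w} (w<m : w < m) u → adj u (fromℕ< w<m) ≡ Sym R (toℕ u) w
  adj-fromℕ< w<m u = cong (Sym R (toℕ u)) (toℕ-fromℕ< w<m)

  private
    entries< : ∀ {prev xs} → LegalℕFrom (Sym R) m prev xs → All (_< m) xs
    entries< [] = []
    entries< (step _ v<m _ _ _ l) = v<m ∷ entries< l

    asVertices : (xs : List ℕ) → All (_< m) xs → ∃ λ (vs : List (Fin m)) → map toℕ vs ≡ xs
    asVertices [] [] = [] , refl
    asVertices (x ∷ xs) (x<m ∷ xs<m) with asVertices xs xs<m
    ... | vs , eq = fromℕ< x<m ∷ vs , cong₂ _∷_ (toℕ-fromℕ< x<m) eq

    transport : ∀ (prev vs : List (Fin m)) →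
                LegalℕFrom (Sym R) m (map toℕ prev) (map toℕ vs) →
                LegalFrom (graphOf R irr m) prev vs
    transport prev [] _ = []
    transport prev (v ∷ vs) (step w _ w<m vw avoid l) =
      (fromℕ< w<m , trans (adj-fromℕ< w<m v) vw ,
       λ u u∈ → trans (adj-fromℕ< w<m u) (All.lookup avoid (∈-map⁺ toℕ u∈)))
      ∷ transport (v ∷ prev) vs l

  legalℕ⇒legal : ∀ xs → LegalℕFrom (Sym R) m [] xs →
                 ∃ λ vs → Legal (graphOf R irr m) vs × length vs ≡ length xs
  legalℕ⇒legal xs l with asVertices xs (entries< l)
  ... | vs , refl = vs , (legalFrom⇒unique _ l′ , l′) , sym (length-map toℕ vs)
    where
    l′ : LegalFrom (graphOf R irr m) [] vs
    l′ = transport [] vs l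

  grundy-fromℕ : ∀ xs {n} → LegalℕFrom (Sym R) m [] xs → length xs ≡ n →
                 (∀ vs → Legal (graphOf R irr m) vs → length vs ≤ n) →
                 GrundyTotalDom≡ (graphOf R irr m) n
  grundy-fromℕ xs l refl bound with legalℕ⇒legal xs l
  ... | vs , legal , len = (vs , legal , len) , bound

  TwoNeighboursℕ : ℕ → Set
  TwoNeighboursℕ x = ∃₂ λ a b → a ≢ b × a < m × b < m × Sym R x a ≡ true × Sym R x b ≡ true

  twoNeighbours-fromℕ : (∀ x → x < m → TwoNeighboursℕ x) →
                        ∀ v → TwoNeighbours (graphOf R irr m) v
  twoNeighbours-fromℕ two v with two (toℕ v) (toℕ<n v)
  ... | a , b , a≢b , a<m , b<m , va , vb =
    fromℕ< a<m , fromℕ< b<m , (λ e → a≢b (fromℕ<-injective a b a<m b<m e)) ,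
    trans (adj-fromℕ< a<m v) va , trans (adj-fromℕ< b<m v) vb

-- Doubling, and the perfect matching {2i, 2i+1} on ℕ (oriented from 2i).

double : ℕ → ℕ
double zero = zero
double (suc k) = suc (suc (double k))

matching : ℕ → ℕ → Bool
matching zero (suc zero) = true
matching (suc (suc a)) (suc (suc b)) = matching a b
matching _ _ = false

matching-irrefl : ∀ a → matching a a ≡ false
matching-irrefl zero = refl
matching-irrefl (suc zero) = refl
matching-irrefl (suc (suc a)) = matching-irrefl a

matched : ∀ i → Sym matching (double i) (suc (double i)) ≡ true
                × Sym matching (suc (double i)) (double i) ≡ true
matched zero = refl , refl
matched (suc i) = matched i

matching-apart : ∀ i u → u < double i →
                 Sym matching u (double i) ≡ false × Sym matching u (suc (double i)) ≡ false
matching-apart (suc i) zero _ = refl , refl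
matching-apart (suc i) (suc zero) _ = refl , refl
matching-apart (suc i) (suc (suc u)) (s≤s (s≤s u<)) = matching-apart i u u<

pair<double : ∀ {t k} → t < k → suc (double t) < double k
pair<double {zero}  {suc k} _         = s≤s (s≤s z≤n)
pair<double {suc t} {suc k} (s≤s t<k) = s≤s (s≤s (pair<double t<k))

partner : ℕ → ℕ
partner zero = 1
partner (suc zero) = 0
partner (suc (suc a)) = suc (suc (partner a))

matching-partner : ∀ y → Sym matching y (partner y) ≡ true
matching-partner zero = refl
matching-partner (suc zero) = refl
matching-partner (suc (suc y)) = matching-partner y

partner< : ∀ J y → y < double J → partner y < double J
partner< (suc J) zero _ = s≤s (s≤s z≤n)
partner< (suc J) (suc zero) _ = s≤s z≤n
partner< (suc J) (suc (suc y)) (s≤s (s≤s y<)) = s≤s (s≤s (partner< J y y<))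

-- Appending a run of matched pairs {o+2i, o+2i+1} to a legal sequence: each
-- vertex of a pair uses its partner as new neighbour.  Quiet i u says that u
-- may have been chosen before the i-th pair without touching it.
module MatchedPairs (A : ℕ → ℕ → Bool) (m o : ℕ) (Quiet : ℕ → ℕ → Set)
  (irrefl : ∀ u → A u u ≡ false)
  (paired : ∀ i → A (o + double i) (suc (o + double i)) ≡ true
                × A (suc (o + double i)) (o + double i) ≡ true)
  (apart  : ∀ i {u} → Quiet i u →
            A u (o + double i) ≡ false × A u (suc (o + double i)) ≡ false)
  (enter  : ∀ i → Quiet (suc i) (o + double i) × Quiet (suc i) (suc (o + double i)))
  (stay   : ∀ i {u} → Quiet i u → Quiet (suc i) u)
  where

  pairs : ℕ → ℕ → List ℕ
  pairs i zero = []
  pairs i (suc j) = o + double i ∷ suc (o + double i) ∷ pairs (suc i) j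

  pairs-length : ∀ i j (rest : List ℕ) → length (pairs i j ++ rest) ≡ double j + length rest
  pairs-length i zero rest = refl
  pairs-length i (suc j) rest = cong (λ k → suc (suc k)) (pairs-length (suc i) j rest)

  -- Starting from vertices quiet for pair i, the pairs i, …, i+j−1 can be
  -- chosen, after which everything chosen is quiet for pair i+j.
  run : ∀ i j {prev} rest → All (Quiet i) prev →
        (∀ t → t < i + j → suc (o + double t) < m) →
        (∀ {prev′} → All (Quiet (i + j)) prev′ → LegalℕFrom A m prev′ rest) →
        LegalℕFrom A m prev (pairs i j ++ rest)
  run i zero rest quiet _ continue rewrite +-identityʳ i = continue quiet
  run i (suc j) {prev} rest quiet inside continue rewrite +-suc i j =
    step (suc x) x<m y<m (proj₁ (paired i)) (All.map (proj₂ ∘ apart i) quiet)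
    (step x y<m x<m (proj₂ (paired i)) (irrefl x ∷ All.map (proj₁ ∘ apart i) quiet)
      (run (suc i) j rest quiet′ inside continue))
    where
    x : ℕ
    x = o + double i
    y<m : suc x < m
    y<m = inside i (s≤s (m≤m+n i j))
    x<m : x < m
    x<m = <-trans ≤-refl y<m
    quiet′ : All (Quiet (suc i)) (suc x ∷ x ∷ prev)
    quiet′ = proj₂ (enter i) ∷ proj₁ (enter i) ∷ All.map (stay i) quiet

matchingGraph : ℕ → Graph
matchingGraph k = graphOf matching matching-irrefl (double k)

module MatchingRun (k : ℕ) = MatchedPairs (Sym matching) (double k) 0 (λ i u → u < double i)
  (Sym-irrefl {matching} matching-irrefl) matched (λ i → matching-apart i _)
  (λ i → m<n⇒m<1+n ≤-refl , ≤-refl) (λ i u< → m<n⇒m<1+n (m<n⇒m<1+n u<))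

-- All pairs in order form a legal sequence; distinctness gives the bound.
matchingGraph-grundy : ∀ k → GrundyTotalDom≡ (matchingGraph k) (double k)
matchingGraph-grundy k =
  grundy-fromℕ matching matching-irrefl (double k) (pairs 0 k ++ [])
    (run 0 k [] [] (λ _ → pair<double) (λ _ → []))
    (trans (pairs-length 0 k []) (+-identityʳ (double k)))
    (legal-length≤ (matchingGraph k))
  where open MatchingRun k

oddRel : ℕ → ℕ → Bool
oddRel 0 1 = true
oddRel 0 (suc (suc (suc (suc _)))) = true
oddRel 1 2 = true
oddRel 1 3 = true
oddRel 2 3 = true
oddRel (suc (suc (suc (suc a)))) (suc (suc (suc (suc b)))) = matching a b
oddRel _ _ = false

oddRel-irrefl : ∀ a → oddRel a a ≡ false
oddRel-irrefl 0 = refl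
oddRel-irrefl 1 = refl
oddRel-irrefl 2 = refl
oddRel-irrefl 3 = refl
oddRel-irrefl (suc (suc (suc (suc a)))) = matching-irrefl a

oddGraph : ℕ → Graph
oddGraph J = graphOf oddRel oddRel-irrefl (6 + double J)

-- Before pair i of the matching (vertices 6+2i, 7+2i), a vertex is quiet if
-- it is smaller and is neither 0 nor 5: these are the neighbours of 4, the
-- new neighbour the hub uses at the very end.
OddQuiet : ℕ → ℕ → Set
OddQuiet i u = u < 6 + double i × u ≢ 0 × u ≢ 5

oddRel-apart : ∀ i {u} → OddQuiet i u →
               Sym oddRel u (6 + double i) ≡ false × Sym oddRel u (7 + double i) ≡ false
oddRel-apart i {0} (_ , u≢0 , _) = contradiction refl u≢0
oddRel-apart i {1} _ = refl , refl
oddRel-apart i {2} _ = refl , refl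
oddRel-apart i {3} _ = refl , refl
oddRel-apart i {suc (suc (suc (suc u)))} (s≤s (s≤s (s≤s (s≤s u<))) , _) =
  matching-apart (suc i) u u<

hub-witness : ∀ {u} → u ≢ 0 → u ≢ 5 → Sym oddRel u 4 ≡ false
hub-witness {0} u≢0 _ = contradiction refl u≢0
hub-witness {1} _ _ = refl
hub-witness {2} _ _ = refl
hub-witness {3} _ _ = refl
hub-witness {4} _ _ = refl
hub-witness {5} _ u≢5 = contradiction refl u≢5
hub-witness {suc (suc (suc (suc (suc (suc _)))))} _ _ = refl

module OddRun (J : ℕ) = MatchedPairs (Sym oddRel) (6 + double J) 6 OddQuiet
  (Sym-irrefl {oddRel} oddRel-irrefl) (λ i → matched (suc i)) oddRel-apart
  (λ i → (m<n⇒m<1+n ≤-refl , (λ ()) , (λ ())) , (≤-refl , (λ ()) , (λ ())))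
  (λ i (u< , u≢0 , u≢5) → m<n⇒m<1+n (m<n⇒m<1+n u<) , u≢0 , u≢5)

module _ (J : ℕ) where
  open OddRun J

  gadget : ∀ x → {True (x <? 6)} → x < 6 + double J
  gadget x {x<6} = ≤-trans (toWitness x<6) (m≤m+n 6 (double J))

  -- 2 3 1 4 with new neighbours 3 2 0 5, then the pairs from 6 on, then the
  -- hub 0 with new neighbour 4.
  oddSequence : List ℕ
  oddSequence = 2 ∷ 3 ∷ 1 ∷ 4 ∷ pairs 0 J ++ 0 ∷ []

  oddSequence-legal : LegalℕFrom (Sym oddRel) (6 + double J) [] oddSequence
  oddSequence-legal =
    step 3 (gadget 2) (gadget 3) refl [] (
    step 2 (gadget 3) (gadget 2) refl (refl ∷ []) (
    step 0 (gadget 1) (gadget 0) refl (refl ∷ refl ∷ []) (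
    step 5 (gadget 4) (gadget 5) refl (refl ∷ refl ∷ refl ∷ []) (
    run 0 J (0 ∷ []) gadgetQuiet (λ _ t<J → +-monoʳ-≤ 6 (pair<double t<J)) hubLast))))
    where
    quiet : ∀ x → {True (x <? 6)} → x ≢ 0 → x ≢ 5 → OddQuiet 0 x
    quiet x {x<6} x≢0 x≢5 = toWitness x<6 , x≢0 , x≢5
    gadgetQuiet : All (OddQuiet 0) (4 ∷ 1 ∷ 3 ∷ 2 ∷ [])
    gadgetQuiet = quiet 4 (λ ()) (λ ()) ∷ quiet 1 (λ ()) (λ ()) ∷
                  quiet 3 (λ ()) (λ ()) ∷ quiet 2 (λ ()) (λ ()) ∷ []
    hubLast : ∀ {prev} → All (OddQuiet J) prev → LegalℕFrom (Sym oddRel) (6 + double J) prev (0 ∷ [])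
    hubLast allQuiet = step 4 (gadget 0) (gadget 4) refl
      (All.map (λ (_ , u≢0 , u≢5) → hub-witness u≢0 u≢5) allQuiet) []

  oddNeighbours : ∀ x → x < 6 + double J → TwoNeighboursℕ oddRel oddRel-irrefl (6 + double J) x
  oddNeighbours 0 _ = 1 , 4 , (λ ()) , gadget 1 , gadget 4 , refl , refl
  oddNeighbours 1 _ = 0 , 2 , (λ ()) , gadget 0 , gadget 2 , refl , refl
  oddNeighbours 2 _ = 1 , 3 , (λ ()) , gadget 1 , gadget 3 , refl , refl
  oddNeighbours 3 _ = 1 , 2 , (λ ()) , gadget 1 , gadget 2 , refl , refl
  oddNeighbours 4 _ = 0 , 5 , (λ ()) , gadget 0 , gadget 5 , refl , refl
  oddNeighbours 5 _ = 0 , 4 , (λ ()) , gadget 0 , gadget 4 , refl , refl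
  oddNeighbours (suc (suc (suc (suc (suc (suc y)))))) (s≤s (s≤s (s≤s (s≤s (s≤s (s≤s y<)))))) =
    0 , 6 + partner y , (λ ()) , gadget 0 , +-monoʳ-≤ 6 (partner< J y y<) ,
    refl , matching-partner y

  -- The sequence has 4 + (2J + 1) entries; minimum degree 2 gives the bound.
  oddGraph-grundy : GrundyTotalDom≡ (oddGraph J) (5 + double J)
  oddGraph-grundy =
    grundy-fromℕ oddRel oddRel-irrefl (6 + double J) oddSequence oddSequence-legal
      (cong (4 +_) (trans (pairs-length 0 J (0 ∷ [])) (+-comm (double J) 1)))
      (legal-length≤pred (oddGraph J)
        (twoNeighbours-fromℕ oddRel oddRel-irrefl (6 + double J) oddNeighbours))

parity : ∀ n → (∃ λ k → n ≡ double k) ⊎ (∃ λ k → n ≡ suc (double k))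
parity zero = inj₁ (0 , refl)
parity (suc zero) = inj₂ (0 , refl)
parity (suc (suc n)) with parity n
... | inj₁ (k , refl) = inj₁ (suc k , refl)
... | inj₂ (k , refl) = inj₂ (suc k , refl)

-- Split n by parity; n = 1 and n = 3 are excluded, every other odd n is
-- 5 + 2J.
theorem3p10 : (n : ℕ) → 1 ≤ n → n ≢ 1 → n ≢ 3 →
    ∃ λ (G : Graph) → GrundyTotalDom≡ G n
theorem3p10 n _ n≢1 n≢3 with parity n
... | inj₁ (k , refl) = matchingGraph k , matchingGraph-grundy k
... | inj₂ (0 , refl) = contradiction refl n≢1
... | inj₂ (1 , refl) = contradiction refl n≢3
... | inj₂ (suc (suc J) , refl) = oddGraph J , oddGraph-grundy J
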